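{- For all positive integers $c$ and $n$, every weakly $c$-closed graph on $n$ vertices has at most $3^{(c-1)/3} n^2$ maximal cliques.
   Context: All graphs are finite, simple and undirected. Given a graph and a positive integer $c$, a bad pair is a pair of non-adjacent distinct vertices having at least $c$ common neighbors. A graph is weakly $c$-closed if there is an ordering $v_1,\dots,v_n$ of its vertices such that for every $i$, the vertex $v_i$ belongs to no bad pair in the subgraph induced by $\{v_i,v_{i+1},\dots,v_n\}$. A maximal clique is a clique (set of pairwise adjacent vertices) not contained in any strictly larger clique. -}

module Defs where

open import Data.Nat using (ℕ)
open import Data.Fin using (Fin; _≤_)
open import Data.Fin.Subset using (Subset; _∈_; _⊆_)
open import Data.Fin.Permutation using (Permutation′; _⟨$⟩ʳ_)
open import Data.Product using (Σ; ∃; _×_)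
open import Function.Definitions using (Injective)
open import Relation.Nullary using (¬_)
open import Relation.Binary.PropositionalEquality using (_≡_; _≢_)

record Graph (n : ℕ) : Set₁ where
  field
    Adj    : Fin n → Fin n → Set
    sym    : ∀ {x y} → Adj x y → Adj y x
    irrefl : ∀ {x} → ¬ Adj x x
open Graph public

BadPairIn : ∀ {n} → Graph n → (Fin n → Set) → ℕ → Fin n → Fin n → Set
BadPairIn {n} G S c u v =
  S u × S v × u ≢ v × ¬ Adj G u v ×
  Σ (Fin c → Fin n) λ f → Injective _≡_ _≡_ f ×
    (∀ k → S (f k) × Adj G u (f k) × Adj G v (f k))

-- The vertices v_i, v_{i+1}, …, v_n for an ordering σ (v_j = σ j).
Suffix : ∀ {n} → Permutation′ n → Fin n → Fin n → Set
Suffix σ i x = ∃ λ j → i ≤ j × σ ⟨$⟩ʳ j ≡ x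

WeaklyClosed : ℕ → ∀ {n} → Graph n → Set
WeaklyClosed c {n} G =
  Σ (Permutation′ n) λ σ →
    ∀ i v → ¬ BadPairIn G (Suffix σ i) c (σ ⟨$⟩ʳ i) v

IsClique : ∀ {n} → Graph n → Subset n → Set
IsClique G S = ∀ x y → x ∈ S → y ∈ S → x ≢ y → Adj G x y

IsMaximalClique : ∀ {n} → Graph n → Subset n → Set
IsMaximalClique G S = IsClique G S × (∀ T → IsClique G T → S ⊆ T → S ≡ T)

module Submission where

-- Moon–Moser: a graph on s vertices has at most 3^(s/3) maximal cliques. Let u have the fewest
-- non-neighbours, e of them counting u itself. Every maximal clique contains one of these e
-- vertices x, and removing x leaves a maximal clique of the neighbourhood of x, which has at
-- most s - e vertices; so there are at most e · 3^((s-e)/3) ≤ 3^(s/3) maximal cliques.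
--
-- Peel off the vertices v₁, v₂, … of a weakly c-closed graph in the order witnessing weak
-- closure. A maximal clique K of the graph on {vᵢ, vᵢ₊₁, …} either leaves a maximal clique
-- K - vᵢ of the graph on {vᵢ₊₁, …}, which determines K, or contains vᵢ and K - vᵢ is extended
-- by a later non-neighbour w of vᵢ. In the second case K - vᵢ is a maximal clique among the
-- at most c - 1 later common neighbours of vᵢ and w, so Moon–Moser leaves at most 3^((c-1)/3)
-- choices per w. Summing over the steps gives (1 + 0 + 1 + ⋯ + (n - 1)) · 3^((c-1)/3), at most
-- n² · 3^((c-1)/3). All bounds are compared as cubes to stay within ℕ.

open import Defs hiding (sym)
open import Data.Nat using (ℕ; _≤_; _^_; _*_; _∸_)
open import Data.List using (List; length)
open import Data.List.Relation.Unary.All using (All)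
open import Data.List.Relation.Unary.Unique.Propositional using (Unique)
open import Data.Fin.Subset using (Subset)

open import Data.Empty using (⊥-elim)
open import Data.Fin using (Fin; zero; suc; toℕ; fromℕ<)
import Data.Fin.Properties as F
open import Data.Fin.Properties using (toℕ-fromℕ<; toℕ-injective; toℕ<n)
open import Data.Fin.Permutation using (Permutation′; _⟨$⟩ʳ_; _⟨$⟩ˡ_; inverseˡ; inverseʳ)
open import Data.Fin.Subset
  using (_∈_; _∉_; _⊆_; Empty; inside; outside; ∣_∣; _∩_; _─_; _-_; ⁅_⁆; _∪_; ⊤)
open import Data.Fin.Subset.Properties
open import Data.List using ([]; _∷_; map; filter)
open import Data.List.Extrema.Nat using (argmin; argmin-all; f[argmin]≤f[⊤]; f[argmin]≤f[xs])
open import Data.List.Membership.Propositional using (lose) renaming (_∈_ to _∈ˡ_)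
open import Data.List.Membership.Propositional.Properties using (∈-map⁺; ∈-map⁻)
open import Data.List.Properties using (length-map)
open import Data.List.Relation.Unary.All using ([]; _∷_)
import Data.List.Relation.Unary.All as All
import Data.List.Relation.Unary.All.Properties as All
open import Data.List.Relation.Unary.AllPairs using ([]; _∷_)
open import Data.List.Relation.Unary.Any using (Any; here; there)
import Data.List.Relation.Unary.Any as Any
import Data.List.Relation.Unary.Unique.Propositional.Properties as Unique
open import Data.Nat using (zero; suc; _+_; _<_; z≤n; s≤s; _≤?_)
open import Data.Nat.Induction using (<-wellFounded)
open import Data.Nat.Properties
open import Data.Nat.Tactic.RingSolver using (solve-∀)
open import Data.Product using (Σ; ∃-syntax; _×_; _,_; proj₁; proj₂)
open import Data.Sum using (_⊎_; inj₁; inj₂)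
import Data.Sum as Sum
open import Data.Vec using ([]; _∷_; tabulate; here; there)
open import Data.Vec.Properties using (lookup∘tabulate; lookup⇒[]=; []=⇒lookup)
open import Function using (_∘_)
open import Function.Definitions using (Injective)
import Induction.WellFounded as WF
open import Level using (0ℓ)
import Relation.Binary.Construct.On as On
open import Relation.Binary.PropositionalEquality
open import Relation.Nullary using (¬_; Dec; yes; no)
open import Relation.Nullary.Decidable
  using (does; dec-true; decidable-stable; ¬¬-excluded-middle; ¬?; _×-dec_; _→-dec_)
open import Relation.Unary as U using (Decidable)
open import Relation.Unary.Properties using (∁?)

-- m ≤ N · ∛Q, stated without cube roots.
record _≤_·∛_ (m N Q : ℕ) : Set where
  constructor ·∛-intro
  field
    root : ℕ
    root³≤ : root ^ 3 ≤ Q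
    m≤N*root : m ≤ N * root

infix 4 _≤_·∛_

·∛-weaken : ∀ {m N N′ Q Q′} → N ≤ N′ → Q ≤ Q′ → m ≤ N ·∛ Q → m ≤ N′ ·∛ Q′
·∛-weaken N≤N′ Q≤Q′ (·∛-intro t t³≤Q m≤Nt) = ·∛-intro t (≤-trans t³≤Q Q≤Q′) (≤-trans m≤Nt (*-monoˡ-≤ t N≤N′))

·∛-zero : ∀ {Q} → 0 ≤ 0 ·∛ Q
·∛-zero = ·∛-intro 0 z≤n z≤n

cube⇒·∛ : ∀ {m Q} → m ^ 3 ≤ Q → m ≤ 1 ·∛ Q
cube⇒·∛ {m} m³≤Q = ·∛-intro m m³≤Q (≤-reflexive (sym (*-identityˡ m)))

-- The larger of the two roots serves for the sum.
·∛-+ : ∀ {m₁ m₂ N₁ N₂ Q} → m₁ ≤ N₁ ·∛ Q → m₂ ≤ N₂ ·∛ Q → m₁ + m₂ ≤ N₁ + N₂ ·∛ Q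
·∛-+ {N₁ = N₁} {N₂} (·∛-intro t₁ t₁³≤ m₁≤) (·∛-intro t₂ t₂³≤ m₂≤) with ≤-total t₁ t₂
... | inj₁ t₁≤t₂ = ·∛-intro t₂ t₂³≤ (≤-trans (+-mono-≤ (≤-trans m₁≤ (*-monoʳ-≤ N₁ t₁≤t₂)) m₂≤)
                                            (≤-reflexive (sym (*-distribʳ-+ t₂ N₁ N₂))))
... | inj₂ t₂≤t₁ = ·∛-intro t₁ t₁³≤ (≤-trans (+-mono-≤ m₁≤ (≤-trans m₂≤ (*-monoʳ-≤ N₂ t₂≤t₁)))
                                            (≤-reflexive (sym (*-distribʳ-+ t₁ N₁ N₂))))

·∛⇒cube : ∀ {m N Q} → m ≤ N ·∛ Q → m ^ 3 ≤ N ^ 3 * Q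
·∛⇒cube {m} {N} {Q} (·∛-intro t t³≤Q m≤Nt) = begin
  m ^ 3       ≤⟨ ^-monoˡ-≤ 3 m≤Nt ⟩
  (N * t) ^ 3 ≡⟨ cube-* N t ⟩
  N ^ 3 * t ^ 3 ≤⟨ *-monoʳ-≤ (N ^ 3) t³≤Q ⟩
  N ^ 3 * Q   ∎
  where
  open ≤-Reasoning
  cube-* : ∀ a b → (a * b) ^ 3 ≡ a ^ 3 * b ^ 3
  cube-* a b = expanded a b
    where
    expanded : ∀ a b → (a * b) * ((a * b) * ((a * b) * 1)) ≡ (a * (a * (a * 1))) * (b * (b * (b * 1)))
    expanded = solve-∀

n³≤3ⁿ : ∀ n → n ^ 3 ≤ 3 ^ n
n³≤3ⁿ 0 = z≤n
n³≤3ⁿ 1 = s≤s z≤n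
n³≤3ⁿ 2 = n≤1+n 8
n³≤3ⁿ 3 = ≤-refl
n³≤3ⁿ (suc (suc (suc (suc k)))) = ≤-trans (step k) (*-monoʳ-≤ 3 (n³≤3ⁿ (suc (suc (suc k)))))
  where
  expanded : ∀ k → 3 * ((3 + k) * ((3 + k) * ((3 + k) * 1)))
                 ≡ (4 + k) * ((4 + k) * ((4 + k) * 1)) + (2 * (k * k * k) + 15 * (k * k) + 33 * k + 17)
  expanded = solve-∀
  step : ∀ k → (4 + k) ^ 3 ≤ 3 * (3 + k) ^ 3
  step k = ≤-trans (m≤m+n _ _) (≤-reflexive (sym (expanded k)))

m³*3^[n∸m]≤3ⁿ : ∀ {m n} → m ≤ n → m ^ 3 * 3 ^ (n ∸ m) ≤ 3 ^ n
m³*3^[n∸m]≤3ⁿ {m} {n} m≤n = begin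
  m ^ 3 * 3 ^ (n ∸ m) ≤⟨ *-monoˡ-≤ (3 ^ (n ∸ m)) (n³≤3ⁿ m) ⟩
  3 ^ m * 3 ^ (n ∸ m) ≡⟨ ^-distribˡ-+-* 3 m (n ∸ m) ⟨
  3 ^ (m + (n ∸ m))   ≡⟨ cong (3 ^_) (m+[n∸m]≡n m≤n) ⟩
  3 ^ n               ∎
  where open ≤-Reasoning

-- 1 + k(k - 1)/2: one class per remaining vertex at each of k peeling steps, plus the empty clique.
tri : ℕ → ℕ
tri zero = 1
tri (suc k) = tri k + k

tri-mono-≤ : ∀ {k l} → k ≤ l → tri k ≤ tri l
tri-mono-≤ {zero} {zero} _ = ≤-refl
tri-mono-≤ {zero} {suc l} _ = ≤-trans (tri-mono-≤ {zero} {l} z≤n) (m≤m+n (tri l) l)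
tri-mono-≤ {suc k} {suc l} (s≤s k≤l) = +-mono-≤ (tri-mono-≤ k≤l) k≤l

tri≤k² : ∀ k → 1 ≤ k → tri k ≤ k * k
tri≤k² (suc zero) _ = ≤-refl
tri≤k² (suc (suc k)) _ = begin
  tri (suc k) + suc k               ≤⟨ +-monoˡ-≤ (suc k) (tri≤k² (suc k) (s≤s z≤n)) ⟩
  suc k * suc k + suc k             ≤⟨ m≤m+n _ (suc (suc k)) ⟩
  suc k * suc k + suc k + suc (suc k) ≡⟨ expanded k ⟩
  suc (suc k) * suc (suc k)         ∎
  where
  open ≤-Reasoning
  expanded : ∀ k → (1 + k) * (1 + k) + (1 + k) + (2 + k) ≡ (2 + k) * (2 + k)
  expanded = solve-∀

-- At most N · ∛Q elements satisfy P, counted through duplicate-free lists.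
#_≤_·∛_ : {A : Set} → (A → Set) → ℕ → ℕ → Set
# P ≤ N ·∛ Q = ∀ {L} → Unique L → All P L → length L ≤ N ·∛ Q

infix 4 #_≤_·∛_

module _ {A : Set} where

  #-mono : ∀ {P R : A → Set} {N Q} → P U.⊆ R → # R ≤ N ·∛ Q → # P ≤ N ·∛ Q
  #-mono P⊆R #R uL PL = #R uL (All.map P⊆R PL)

  #-weaken : ∀ {P : A → Set} {N N′ Q Q′} → N ≤ N′ → Q ≤ Q′ → # P ≤ N ·∛ Q → # P ≤ N′ ·∛ Q′
  #-weaken N≤N′ Q≤Q′ #P uL PL = ·∛-weaken N≤N′ Q≤Q′ (#P uL PL)

  #-subsingleton : ∀ {P : A → Set} {Q} → 1 ≤ Q → (∀ {a b} → P a → P b → a ≡ b) → # P ≤ 1 ·∛ Q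
  #-subsingleton _ _ {[]} _ _ = cube⇒·∛ z≤n
  #-subsingleton 1≤Q _ {_ ∷ []} _ _ = cube⇒·∛ 1≤Q
  #-subsingleton 1≤Q P-unique {_ ∷ _ ∷ _} ((a≢b ∷ _) ∷ _) (Pa ∷ Pb ∷ _) = ⊥-elim (a≢b (P-unique Pa Pb))

  Unique-map⁺ : ∀ {B : Set} {P : A → Set} {f : A → B} {L} →
    (∀ {a b} → P a → P b → f a ≡ f b → a ≡ b) → All P L → Unique L → Unique (map f L)
  Unique-map⁺ f-inj [] [] = []
  Unique-map⁺ f-inj (Pa ∷ PL) (a∉L ∷ uL) =
    All.map⁺ (All.zipWith (λ (Pb , a≢b) → a≢b ∘ f-inj Pa Pb) (PL , a∉L)) ∷ Unique-map⁺ f-inj PL uL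

  #-map : ∀ {B : Set} {P : A → Set} {R : B → Set} {N Q} (f : A → B) →
    (∀ {a} → P a → R (f a)) → (∀ {a b} → P a → P b → f a ≡ f b → a ≡ b) →
    # R ≤ N ·∛ Q → # P ≤ N ·∛ Q
  #-map f f-R f-inj #R {L} uL PL = subst (_≤ _ ·∛ _) (length-map f L)
    (#R (Unique-map⁺ f-inj PL uL) (All.map⁺ (All.map f-R PL)))

  length-filter+length-filter-∁ : ∀ {P : A → Set} (P? : Decidable P) L →
    length (filter P? L) + length (filter (∁? P?) L) ≡ length L
  length-filter+length-filter-∁ P? [] = refl
  length-filter+length-filter-∁ P? (a ∷ L) with P? a
  ... | yes _ = cong suc (length-filter+length-filter-∁ P? L)
  ... | no _ = trans (+-suc _ _) (cong suc (length-filter+length-filter-∁ P? L))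

  #-∪ : ∀ {P R : A → Set} {N M Q} → Decidable P →
    # P ≤ N ·∛ Q → # R ≤ M ·∛ Q → # (P U.∪ R) ≤ N + M ·∛ Q
  #-∪ {P} {R} P? #P #R {L} uL P∪RL =
    subst (_≤ _ ·∛ _) (length-filter+length-filter-∁ P? L)
      (·∛-+ (#P (Unique.filter⁺ P? uL) (All.all-filter P? L))
            (#R (Unique.filter⁺ (∁? P?) uL)
                (All.zipWith only-R (All.all-filter (∁? P?) L , All.filter⁺ (∁? P?) P∪RL))))
    where
    only-R : ∀ {a} → ¬ P a × (P a ⊎ R a) → R a
    only-R (¬Pa , inj₁ Pa) = ⊥-elim (¬Pa Pa)
    only-R (_ , inj₂ Ra) = Ra

  #-Any : ∀ {I : Set} {P : I → A → Set} {Q} (P? : ∀ i → Decidable (P i)) (Is : List I) →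
    (∀ {i} → i ∈ˡ Is → # P i ≤ 1 ·∛ Q) → # (λ a → Any (λ i → P i a) Is) ≤ length Is ·∛ Q
  #-Any P? [] #P {[]} _ _ = ·∛-zero
  #-Any P? [] #P {_ ∷ _} _ (() ∷ _)
  #-Any P? (i ∷ Is) #P = #-mono Any.toSum
    (#-∪ (P? i) (#P (here refl)) (#-Any P? Is (#P ∘ there)))

module _ {n : ℕ} where

  subsetOf : {P : Fin n → Set} → Decidable P → Subset n
  subsetOf P? = tabulate (does ∘ P?)

  module _ {P : Fin n → Set} (P? : Decidable P) {x : Fin n} where

    ∈-subsetOf⁺ : P x → x ∈ subsetOf P?
    ∈-subsetOf⁺ Px = lookup⇒[]= x _ (trans (lookup∘tabulate _ x) (dec-true (P? x) Px))

    ∈-subsetOf⁻ : x ∈ subsetOf P? → P x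
    ∈-subsetOf⁻ x∈ with P? x | trans (sym (lookup∘tabulate _ x)) ([]=⇒lookup x∈)
    ... | yes Px | _ = Px
    ... | no _ | ()

toList : ∀ {n} → Subset n → List (Fin n)
toList [] = []
toList (inside ∷ p) = zero ∷ map suc (toList p)
toList (outside ∷ p) = map suc (toList p)

length-toList : ∀ {n} (p : Subset n) → length (toList p) ≡ ∣ p ∣
length-toList [] = refl
length-toList (inside ∷ p) = cong suc (trans (length-map suc (toList p)) (length-toList p))
length-toList (outside ∷ p) = trans (length-map suc (toList p)) (length-toList p)

∈-toList⁺ : ∀ {n} {p : Subset n} {x} → x ∈ p → x ∈ˡ toList p
∈-toList⁺ {p = inside ∷ p} here = here refl
∈-toList⁺ {p = inside ∷ p} (there x∈p) = there (∈-map⁺ suc (∈-toList⁺ x∈p))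
∈-toList⁺ {p = outside ∷ p} (there x∈p) = ∈-map⁺ suc (∈-toList⁺ x∈p)

∈-toList⁻ : ∀ {n} {p : Subset n} {x} → x ∈ˡ toList p → x ∈ p
∈-toList⁻ {p = inside ∷ p} (here refl) = here
∈-toList⁻ {p = inside ∷ p} (there x∈) with ∈-map⁻ suc x∈
... | _ , y∈ , refl = there (∈-toList⁻ y∈)
∈-toList⁻ {p = outside ∷ p} x∈ with ∈-map⁻ suc x∈
... | _ , y∈ , refl = there (∈-toList⁻ y∈)

∣p∩q∣+∣p─q∣≡∣p∣ : ∀ {n} (p q : Subset n) → ∣ p ∩ q ∣ + ∣ p ─ q ∣ ≡ ∣ p ∣
∣p∩q∣+∣p─q∣≡∣p∣ [] [] = refl
∣p∩q∣+∣p─q∣≡∣p∣ (inside ∷ p) (inside ∷ q) = cong suc (∣p∩q∣+∣p─q∣≡∣p∣ p q)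
∣p∩q∣+∣p─q∣≡∣p∣ (inside ∷ p) (outside ∷ q) = trans (+-suc _ _) (cong suc (∣p∩q∣+∣p─q∣≡∣p∣ p q))
∣p∩q∣+∣p─q∣≡∣p∣ (outside ∷ p) (inside ∷ q) = ∣p∩q∣+∣p─q∣≡∣p∣ p q
∣p∩q∣+∣p─q∣≡∣p∣ (outside ∷ p) (outside ∷ q) = ∣p∩q∣+∣p─q∣≡∣p∣ p q

x∈p─q⇒x∉q : ∀ {n} {x : Fin n} {p q} → x ∈ p ─ q → x ∉ q
x∈p─q⇒x∉q {p = inside ∷ p} {outside ∷ q} here ()
x∈p─q⇒x∉q {p = _ ∷ p} {_ ∷ q} (there x∈) (there x∈q) = x∈p─q⇒x∉q x∈ x∈q

x∉p-x : ∀ {n} (x : Fin n) (p : Subset n) → x ∉ p - x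
x∉p-x zero (_ ∷ p) ()
x∉p-x (suc x) (_ ∷ p) (there x∈) = x∉p-x x p x∈

x∈p-y⇒x≢y : ∀ {n} {x y : Fin n} {p} → x ∈ p - y → x ≢ y
x∈p-y⇒x≢y {x = x} {p = p} x∈ refl = x∉p-x x p x∈

p-x≡q-x⇒p≡q : ∀ {n} {p q : Subset n} {x} → (x ∈ p → x ∈ q) → (x ∈ q → x ∈ p) → p - x ≡ q - x → p ≡ q
p-x≡q-x⇒p≡q {p = p} {q} {x} p→q q→p eq = ⊆-antisym (⊆-via p→q eq) (⊆-via q→p (sym eq))
  where
  ⊆-via : ∀ {r s} → (x ∈ r → x ∈ s) → r - x ≡ s - x → r ⊆ s
  ⊆-via {r} {s} x-r→s eq {y} y∈r with y F.≟ x
  ... | yes refl = x-r→s y∈r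
  ... | no y≢x = p─q⊆p s ⁅ x ⁆ (subst (y ∈_) eq (x∈p∧x≢y⇒x∈p-y y∈r y≢x))

c≤∣p∣⇒injection : ∀ {n c} (p : Subset n) → c ≤ ∣ p ∣ →
  Σ (Fin c → Fin n) λ f → Injective _≡_ _≡_ f × (∀ k → f k ∈ p)
c≤∣p∣⇒injection [] z≤n = (λ ()) , (λ {}) , (λ ())
c≤∣p∣⇒injection (outside ∷ p) c≤ with c≤∣p∣⇒injection p c≤
... | f , f-inj , f∈p = suc ∘ f , f-inj ∘ F.suc-injective , there ∘ f∈p
c≤∣p∣⇒injection {c = zero} (inside ∷ p) _ = (λ ()) , (λ {}) , (λ ())
c≤∣p∣⇒injection {c = suc c} (inside ∷ p) (s≤s c≤) with c≤∣p∣⇒injection p c≤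
... | f , f-inj , f∈p = g , g-inj , g∈
  where
  g : Fin (suc c) → Fin _
  g zero = zero
  g (suc k) = suc (f k)
  g-inj : Injective _≡_ _≡_ g
  g-inj {zero} {zero} _ = refl
  g-inj {suc k} {suc l} e = cong suc (f-inj (F.suc-injective e))
  g∈ : ∀ k → g k ∈ inside ∷ p
  g∈ zero = here
  g∈ (suc k) = there (f∈p k)

minimiser : ∀ {n} (f : Fin n → ℕ) {S : Subset n} {x} → x ∈ S →
  ∃[ u ] (u ∈ S × ∀ {y} → y ∈ S → f u ≤ f y)
minimiser f {S} x∈S
  with toList S | ∈-toList⁺ x∈S | (λ {y} → ∈-toList⁻ {p = S} {y}) | (λ {y} → ∈-toList⁺ {p = S} {y})
... | x ∷ xs | _ | toList⊆S | S⊆toList = argmin f x xs , u∈S , u-min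
  where
  u∈S : argmin f x xs ∈ S
  u∈S = argmin-all f (toList⊆S (here refl)) (All.tabulate (toList⊆S ∘ there))
  u-min : ∀ {y} → y ∈ S → f (argmin f x xs) ≤ f y
  u-min y∈S with S⊆toList y∈S
  ... | here refl = f[argmin]≤f[⊤] {f = f} x xs
  ... | there y∈xs = All.lookup (f[argmin]≤f[xs] {f = f} x xs) y∈xs

module MaximalCliques {n : ℕ} (G : Graph n) (Adj? : ∀ x y → Dec (Adj G x y)) where

  Γ : Fin n → Subset n
  Γ x = subsetOf (Adj? x)

  x∉Γx : ∀ {x} → x ∉ Γ x
  x∉Γx = irrefl G ∘ ∈-subsetOf⁻ (Adj? _)

  Unextendable : Subset n → Subset n → Set
  Unextendable S K = ∀ z → z ∈ S → z ∉ K → ∃[ y ] (y ∈ K × ¬ Adj G z y)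

  IsMaximalCliqueIn : Subset n → Subset n → Set
  IsMaximalCliqueIn S K = K ⊆ S × IsClique G K × Unextendable S K

  isClique? : ∀ K → Dec (IsClique G K)
  isClique? K = F.all? λ x → F.all? λ y →
    (x ∈? K) →-dec (y ∈? K) →-dec ¬? (x F.≟ y) →-dec Adj? x y

  blocked? : ∀ S K z → Dec (z ∈ S → z ∉ K → ∃[ y ] (y ∈ K × ¬ Adj G z y))
  blocked? S K z = (z ∈? S) →-dec ¬? (z ∈? K) →-dec F.any? λ y → (y ∈? K) ×-dec ¬? (Adj? z y)

  unextendable? : ∀ S K → Dec (Unextendable S K)
  unextendable? S K = F.all? (blocked? S K)

  isMaximalCliqueIn? : ∀ S K → Dec (IsMaximalCliqueIn S K)
  isMaximalCliqueIn? S K = (K ⊆? S) ×-dec isClique? K ×-dec unextendable? S K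

  extension : ∀ {S K} → ¬ Unextendable S K → ∃[ z ] (z ∈ S × z ∉ K × K ⊆ Γ z)
  extension {S} {K} ¬unext with F.¬∀⟶∃¬ n _ (blocked? S K) ¬unext
  ... | z , ¬unext-z = z , z∈S , z∉K , λ {y} y∈K → ∈-subsetOf⁺ (Adj? z) (Adj-z y∈K)
    where
    z∈S : z ∈ S
    z∈S = decidable-stable (z ∈? S) λ z∉S → ¬unext-z (⊥-elim ∘ z∉S)
    z∉K : z ∉ K
    z∉K = λ z∈K → ¬unext-z λ _ z∉K → ⊥-elim (z∉K z∈K)
    Adj-z : ∀ {y} → y ∈ K → Adj G z y
    Adj-z {y} y∈K = decidable-stable (Adj? z y) λ ¬adj → ¬unext-z λ _ _ → y , y∈K , ¬adj

  maximal-restrict : ∀ {S K R} → IsMaximalCliqueIn S K → K ⊆ R → IsMaximalCliqueIn (S ∩ R) K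
  maximal-restrict (K⊆S , clique , unext) K⊆R =
    (λ x∈K → x∈p∩q⁺ (K⊆S x∈K , K⊆R x∈K)) , clique , λ z z∈S∩R → unext z (proj₁ (x∈p∩q⁻ _ _ z∈S∩R))

  maximal-remove : ∀ {S K x} → IsMaximalCliqueIn S K → x ∈ K → IsMaximalCliqueIn (S ∩ Γ x) (K - x)
  maximal-remove {S} {K} {x} (K⊆S , clique , unext) x∈K = K-x⊆ , clique-K-x , unext-K-x
    where
    ∈K : ∀ {y} → y ∈ K - x → y ∈ K
    ∈K = p─q⊆p K ⁅ x ⁆
    K-x⊆ : K - x ⊆ S ∩ Γ x
    K-x⊆ y∈ = x∈p∩q⁺ (K⊆S (∈K y∈) , ∈-subsetOf⁺ (Adj? x) (clique _ _ x∈K (∈K y∈) (x∈p-y⇒x≢y y∈ ∘ sym)))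
    clique-K-x : IsClique G (K - x)
    clique-K-x a b a∈ b∈ = clique a b (∈K a∈) (∈K b∈)
    unext-K-x : Unextendable (S ∩ Γ x) (K - x)
    unext-K-x z z∈ z∉K-x with x∈p∩q⁻ S (Γ x) z∈
    ... | z∈S , z∈Γx with unext z z∈S (λ z∈K → z∉K-x (x∈p∧x≢y⇒x∈p-y z∈K z≢x))
      where
      z≢x : z ≢ x
      z≢x refl = x∉Γx z∈Γx
    ... | y , y∈K , ¬Adj-zy = y , x∈p∧x≢y⇒x∈p-y y∈K y≢x , ¬Adj-zy
      where
      y≢x : y ≢ x
      y≢x refl = ¬Adj-zy (Graph.sym G (∈-subsetOf⁻ (Adj? x) z∈Γx))

  -- Otherwise the witness that x cannot extend K₂ lies in K₁ - x and is adjacent to x.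
  maximal-∈-agree : ∀ {S K₁ K₂ x} → x ∈ S → IsMaximalCliqueIn S K₁ → IsMaximalCliqueIn S K₂ →
    K₁ - x ≡ K₂ - x → x ∈ K₁ → x ∈ K₂
  maximal-∈-agree {K₂ = K₂} {x} x∈S (_ , clique₁ , _) (_ , _ , unext₂) eq x∈K₁ with x ∈? K₂
  ... | yes x∈K₂ = x∈K₂
  ... | no x∉K₂ with unext₂ x x∈S x∉K₂
  ... | y , y∈K₂ , ¬Adj-xy = ⊥-elim (¬Adj-xy (clique₁ x y x∈K₁ y∈K₁ (y≢x ∘ sym)))
    where
    y≢x : y ≢ x
    y≢x refl = x∉K₂ y∈K₂
    y∈K₁ : y ∈ _
    y∈K₁ = p─q⊆p _ ⁅ x ⁆ (subst (y ∈_) (sym eq) (x∈p∧x≢y⇒x∈p-y y∈K₂ y≢x))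

  maximal-remove-injective : ∀ {S K₁ K₂ x} → x ∈ S → IsMaximalCliqueIn S K₁ → IsMaximalCliqueIn S K₂ →
    K₁ - x ≡ K₂ - x → K₁ ≡ K₂
  maximal-remove-injective x∈S max₁ max₂ eq =
    p-x≡q-x⇒p≡q (maximal-∈-agree x∈S max₁ max₂ eq) (maximal-∈-agree x∈S max₂ max₁ (sym eq)) eq

  clique-extend : ∀ {K z} → IsClique G K → K ⊆ Γ z → IsClique G (K ∪ ⁅ z ⁆)
  clique-extend {K} {z} clique K⊆Γz x y x∈ y∈ x≢y with x∈p∪q⁻ K ⁅ z ⁆ x∈ | x∈p∪q⁻ K ⁅ z ⁆ y∈
  ... | inj₁ x∈K | inj₁ y∈K = clique x y x∈K y∈K x≢y
  ... | inj₁ x∈K | inj₂ y∈z rewrite x∈⁅y⁆⇒x≡y z y∈z = Graph.sym G (∈-subsetOf⁻ (Adj? z) (K⊆Γz x∈K))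
  ... | inj₂ x∈z | inj₁ y∈K rewrite x∈⁅y⁆⇒x≡y z x∈z = ∈-subsetOf⁻ (Adj? z) (K⊆Γz y∈K)
  ... | inj₂ x∈z | inj₂ y∈z = ⊥-elim (x≢y (trans (x∈⁅y⁆⇒x≡y z x∈z) (sym (x∈⁅y⁆⇒x≡y z y∈z))))

  maximalClique⇒maximalCliqueIn⊤ : ∀ {K} → IsMaximalClique G K → IsMaximalCliqueIn ⊤ K
  maximalClique⇒maximalCliqueIn⊤ {K} (clique , maximal) =
    ⊆⊤ , clique , decidable-stable (unextendable? ⊤ K) not-unextendable
    where
    not-unextendable : ¬ ¬ Unextendable ⊤ K
    not-unextendable ¬unext with extension ¬unext
    ... | z , _ , z∉K , K⊆Γz = z∉K (subst (z ∈_) (sym K≡K∪z) (q⊆p∪q K ⁅ z ⁆ (x∈⁅x⁆ z)))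
      where
      K≡K∪z : K ≡ K ∪ ⁅ z ⁆
      K≡K∪z = maximal (K ∪ ⁅ z ⁆) (clique-extend clique K⊆Γz) (p⊆p∪q ⁅ z ⁆)

  #-containing : ∀ {S x N Q} → # IsMaximalCliqueIn (S ∩ Γ x) ≤ N ·∛ Q →
    # (λ K → IsMaximalCliqueIn S K × x ∈ K) ≤ N ·∛ Q
  #-containing {x = x} = #-map (_- x) (λ (max , x∈K) → maximal-remove max x∈K)
    (λ (_ , x∈K₁) (_ , x∈K₂) → p-x≡q-x⇒p≡q (λ _ → x∈K₂) (λ _ → x∈K₁))

  maximal-meets-non-neighbours : ∀ {S K u} → u ∈ S → IsMaximalCliqueIn S K → ∃[ x ] (x ∈ S ─ Γ u × x ∈ K)
  maximal-meets-non-neighbours {K = K} {u} u∈S (K⊆S , _ , unext) with u ∈? K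
  ... | yes u∈K = u , x∈p∧x∉q⇒x∈p─q u∈S x∉Γx , u∈K
  ... | no u∉K with unext u u∈S u∉K
  ... | y , y∈K , ¬Adj-uy = y , x∈p∧x∉q⇒x∈p─q (K⊆S y∈K) (¬Adj-uy ∘ ∈-subsetOf⁻ (Adj? u)) , y∈K

  ∣S∩Γx∣<∣S∣ : ∀ {S x} → x ∈ S → ∣ S ∩ Γ x ∣ < ∣ S ∣
  ∣S∩Γx∣<∣S∣ {S} {x} x∈S = p⊂q⇒∣p∣<∣q∣ (p∩q⊆p S (Γ x) , x , x∈S , x∉Γx ∘ proj₂ ∘ x∈p∩q⁻ S (Γ x))

  maximal-in-empty : ∀ {S K₁ K₂} → Empty S → IsMaximalCliqueIn S K₁ → IsMaximalCliqueIn S K₂ → K₁ ≡ K₂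
  maximal-in-empty S-empty (K₁⊆S , _) (K₂⊆S , _) =
    ⊆-antisym (⊥-elim ∘ S-empty ∘ (_ ,_) ∘ K₁⊆S) (⊥-elim ∘ S-empty ∘ (_ ,_) ∘ K₂⊆S)

  moonMoser : ∀ S → # IsMaximalCliqueIn S ≤ 1 ·∛ 3 ^ ∣ S ∣
  moonMoser = WF.All.wfRec (On.wellFounded (∣_∣ {n}) <-wellFounded) 0ℓ
    (λ S → # IsMaximalCliqueIn S ≤ 1 ·∛ 3 ^ ∣ S ∣) step
    where
    non-adj : Subset n → Fin n → ℕ
    non-adj S y = ∣ S ─ Γ y ∣
    step : ∀ S → (∀ {T} → ∣ T ∣ < ∣ S ∣ → # IsMaximalCliqueIn T ≤ 1 ·∛ 3 ^ ∣ T ∣) →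
      # IsMaximalCliqueIn S ≤ 1 ·∛ 3 ^ ∣ S ∣
    step S ih with nonempty? S
    ... | no S-empty = #-subsingleton (^-monoʳ-≤ 3 {0} {∣ S ∣} z≤n) (maximal-in-empty S-empty)
    ... | yes (_ , y∈S) with minimiser (non-adj S) y∈S
    ... | u , u∈S , u-min = λ uL maxL → cube⇒·∛ (≤-trans (·∛⇒cube (bound uL maxL))
                                                         (m³*3^[n∸m]≤3ⁿ (∣p─q∣≤∣p∣ S (Γ u))))
      where
      Q : ℕ
      Q = 3 ^ (∣ S ∣ ∸ non-adj S u)
      ∣S∩Γx∣≤ : ∀ {x} → x ∈ S → ∣ S ∩ Γ x ∣ ≤ ∣ S ∣ ∸ non-adj S u
      ∣S∩Γx∣≤ {x} x∈S = begin
        ∣ S ∩ Γ x ∣                           ≡⟨ m+n∸n≡m _ (non-adj S x) ⟨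
        ∣ S ∩ Γ x ∣ + non-adj S x ∸ non-adj S x ≡⟨ cong (_∸ non-adj S x) (∣p∩q∣+∣p─q∣≡∣p∣ S (Γ x)) ⟩
        ∣ S ∣ ∸ non-adj S x                    ≤⟨ ∸-monoʳ-≤ ∣ S ∣ (u-min x∈S) ⟩
        ∣ S ∣ ∸ non-adj S u                    ∎
        where open ≤-Reasoning
      containing : ∀ {x} → x ∈ˡ toList (S ─ Γ u) → # (λ K → IsMaximalCliqueIn S K × x ∈ K) ≤ 1 ·∛ Q
      containing {x} x∈ = #-containing (#-weaken ≤-refl (^-monoʳ-≤ 3 (∣S∩Γx∣≤ x∈S)) (ih (∣S∩Γx∣<∣S∣ x∈S)))
        where
        x∈S : x ∈ S
        x∈S = p─q⊆p S (Γ u) (∈-toList⁻ x∈)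
      bound : # IsMaximalCliqueIn S ≤ non-adj S u ·∛ Q
      bound = #-weaken (≤-reflexive (length-toList (S ─ Γ u))) ≤-refl
        (#-mono (λ max → let x , x∈ , x∈K = maximal-meets-non-neighbours u∈S max
                         in lose (∈-toList⁺ x∈) (max , x∈K))
                (#-Any (λ x K → isMaximalCliqueIn? S K ×-dec (x ∈? K)) (toList (S ─ Γ u)) containing))

  -- If K - v is not maximal in S - v, some w ∈ S - v extends K - v; maximality of K forces w ≁ v.
  peel-cover : ∀ {S K v} → IsMaximalCliqueIn S K →
    IsMaximalCliqueIn (S - v) (K - v) ⊎ ∃[ w ] (w ∈ S - v ─ Γ v × v ∈ K × K - v ⊆ Γ w)
  peel-cover {S} {K} {v} (K⊆S , clique , unext) with isMaximalCliqueIn? (S - v) (K - v)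
  ... | yes max = inj₁ max
  ... | no ¬max with extension (λ unext-K-v → ¬max (K-v⊆S-v , clique-K-v , unext-K-v))
    where
    K-v⊆S-v : K - v ⊆ S - v
    K-v⊆S-v y∈ = x∈p∧x≢y⇒x∈p-y (K⊆S (p─q⊆p K ⁅ v ⁆ y∈)) (x∈p-y⇒x≢y y∈)
    clique-K-v : IsClique G (K - v)
    clique-K-v a b a∈ b∈ = clique a b (p─q⊆p K ⁅ v ⁆ a∈) (p─q⊆p K ⁅ v ⁆ b∈)
  ... | w , w∈S-v , w∉K-v , K-v⊆Γw
    with unext w (p─q⊆p S ⁅ v ⁆ w∈S-v) (λ w∈K → w∉K-v (x∈p∧x≢y⇒x∈p-y w∈K (x∈p-y⇒x≢y w∈S-v)))
  ... | y , y∈K , ¬Adj-wy with y F.≟ v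
  ... | no y≢v = ⊥-elim (¬Adj-wy (∈-subsetOf⁻ (Adj? w) (K-v⊆Γw (x∈p∧x≢y⇒x∈p-y y∈K y≢v))))
  ... | yes refl = inj₂ (w , x∈p∧x∉q⇒x∈p─q w∈S-v (¬Adj-wy ∘ Graph.sym G ∘ ∈-subsetOf⁻ (Adj? y)) , y∈K , K-v⊆Γw)

  #-peel : ∀ {S v d N} → v ∈ S → (∀ {w} → w ∈ S - v → ¬ Adj G v w → ∣ (S ∩ Γ v) ∩ Γ w ∣ ≤ d) →
    # IsMaximalCliqueIn (S - v) ≤ N ·∛ 3 ^ d → # IsMaximalCliqueIn S ≤ N + ∣ S - v ∣ ·∛ 3 ^ d
  #-peel {S} {v} {d} {N} v∈S few-common #S-v =
    #-weaken (+-monoʳ-≤ N (≤-trans (≤-reflexive (length-toList (S - v ─ Γ v))) (∣p─q∣≤∣p∣ (S - v) (Γ v))))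
             ≤-refl
      (#-mono (λ max → Sum.map (max ,_) (λ (w , w∈ , ext) → lose (∈-toList⁺ w∈) (max , ext)) (peel-cover max))
        (#-∪ (λ K → isMaximalCliqueIn? S K ×-dec isMaximalCliqueIn? (S - v) (K - v)) #kept
          (#-Any (λ w K → isMaximalCliqueIn? S K ×-dec (v ∈? K) ×-dec (K - v ⊆? Γ w))
                 (toList (S - v ─ Γ v)) #extended)))
    where
    #kept : # (λ K → IsMaximalCliqueIn S K × IsMaximalCliqueIn (S - v) (K - v)) ≤ N ·∛ 3 ^ d
    #kept = #-map (_- v) proj₂ (λ (max₁ , _) (max₂ , _) → maximal-remove-injective v∈S max₁ max₂) #S-v
    #extended : ∀ {w} → w ∈ˡ toList (S - v ─ Γ v) →
      # (λ K → IsMaximalCliqueIn S K × v ∈ K × K - v ⊆ Γ w) ≤ 1 ·∛ 3 ^ d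
    #extended {w} w∈ =
      #-map (_- v) (λ (max , v∈K , K-v⊆Γw) → maximal-restrict (maximal-remove max v∈K) K-v⊆Γw)
        (λ (_ , v∈K₁ , _) (_ , v∈K₂ , _) → p-x≡q-x⇒p≡q (λ _ → v∈K₂) (λ _ → v∈K₁))
        (#-weaken ≤-refl (^-monoʳ-≤ 3 (few-common w∈S-v (w∉Γv ∘ ∈-subsetOf⁺ (Adj? v))))
                  (moonMoser ((S ∩ Γ v) ∩ Γ w)))
      where
      w∈S-v : w ∈ S - v
      w∈S-v = p─q⊆p (S - v) (Γ v) (∈-toList⁻ w∈)
      w∉Γv : w ∉ Γ v
      w∉Γv = x∈p─q⇒x∉q {p = S - v} (∈-toList⁻ w∈)

  -- Weak (d + 1)-closure of the graph induced by S.
  data Peelable (d : ℕ) : Subset n → Set where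
    empty : ∀ {S} → Empty S → Peelable d S
    peel : ∀ {S v} → v ∈ S → (∀ {w} → w ∈ S - v → ¬ Adj G v w → ∣ (S ∩ Γ v) ∩ Γ w ∣ ≤ d) →
      Peelable d (S - v) → Peelable d S

  #-peelable : ∀ {d S} → Peelable d S → # IsMaximalCliqueIn S ≤ tri ∣ S ∣ ·∛ 3 ^ d
  #-peelable {d} {S} (empty S-empty) =
    #-weaken (tri-mono-≤ {0} {∣ S ∣} z≤n) ≤-refl
      (#-subsingleton (^-monoʳ-≤ 3 {0} {d} z≤n) (maximal-in-empty S-empty))
  #-peelable (peel v∈S few-common rest) =
    #-weaken (tri-mono-≤ (x∈p⇒∣p-x∣<∣p∣ v∈S)) ≤-refl (#-peel v∈S few-common (#-peelable rest))

  maximalCliques-bound : ∀ {d L} → 1 ≤ n → Peelable d ⊤ → Unique L → All (IsMaximalClique G) L →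
    length L ^ 3 ≤ 3 ^ d * n ^ 6
  maximalCliques-bound {d} {L} 1≤n peelable uL maxL = begin
    length L ^ 3              ≤⟨ ·∛⇒cube (#-weaken tri∣⊤∣≤n² ≤-refl (#-peelable peelable) uL
                                                   (All.map maximalClique⇒maximalCliqueIn⊤ maxL)) ⟩
    (n * n) ^ 3 * 3 ^ d       ≡⟨ expanded n (3 ^ d) ⟩
    3 ^ d * n ^ 6             ∎
    where
    open ≤-Reasoning
    tri∣⊤∣≤n² : tri ∣ ⊤ {n} ∣ ≤ n * n
    tri∣⊤∣≤n² = subst (λ k → tri k ≤ n * n) (sym (∣⊤∣≡n n)) (tri≤k² n 1≤n)
    expanded : ∀ n q → (n * n) * ((n * n) * ((n * n) * 1)) * q ≡ q * (n * (n * (n * (n * (n * (n * 1))))))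
    expanded = solve-∀

module WeaklyClosedOrdering {n c : ℕ} (G : Graph n) (Adj? : ∀ x y → Dec (Adj G x y)) (1≤c : 1 ≤ c)
  (σ : Permutation′ n) (no-bad-pair : ∀ i v → ¬ BadPairIn G (Suffix σ i) c (σ ⟨$⟩ʳ i) v) where

  open MaximalCliques G Adj?

  position : Fin n → ℕ
  position x = toℕ (σ ⟨$⟩ˡ x)

  suffix : ℕ → Subset n
  suffix i = subsetOf (λ x → i ≤? position x)

  ∈-suffix⁺ : ∀ {i x} → i ≤ position x → x ∈ suffix i
  ∈-suffix⁺ {i} = ∈-subsetOf⁺ (λ x → i ≤? position x)

  ∈-suffix⁻ : ∀ {i x} → x ∈ suffix i → i ≤ position x
  ∈-suffix⁻ {i} = ∈-subsetOf⁻ (λ x → i ≤? position x)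

  module _ {i : ℕ} (i<n : i < n) where

    vertex : Fin n
    vertex = σ ⟨$⟩ʳ fromℕ< i<n

    position-vertex : position vertex ≡ i
    position-vertex = trans (cong toℕ (inverseˡ σ)) (toℕ-fromℕ< i<n)

    position≡i⇒≡vertex : ∀ {x} → position x ≡ i → x ≡ vertex
    position≡i⇒≡vertex eq =
      trans (sym (inverseʳ σ)) (cong (σ ⟨$⟩ʳ_) (toℕ-injective (trans eq (sym (toℕ-fromℕ< i<n)))))

    vertex∈suffix : vertex ∈ suffix i
    vertex∈suffix = ∈-suffix⁺ (≤-reflexive (sym position-vertex))

    suffix⇒Suffix : ∀ {x} → x ∈ suffix i → Suffix σ (fromℕ< i<n) x
    suffix⇒Suffix x∈ = σ ⟨$⟩ˡ _ , subst (_≤ position _) (sym (toℕ-fromℕ< i<n)) (∈-suffix⁻ x∈) , inverseʳ σ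

    suffix-vertex≡suffix-suc : suffix i - vertex ≡ suffix (suc i)
    suffix-vertex≡suffix-suc = ⊆-antisym later earlier
      where
      later : suffix i - vertex ⊆ suffix (suc i)
      later x∈ = ∈-suffix⁺ (≤∧≢⇒< (∈-suffix⁻ (p─q⊆p _ ⁅ vertex ⁆ x∈))
                                  (x∈p-y⇒x≢y x∈ ∘ position≡i⇒≡vertex ∘ sym))
      earlier : suffix (suc i) ⊆ suffix i - vertex
      earlier x∈ = x∈p∧x≢y⇒x∈p-y (∈-suffix⁺ (≤-trans (n≤1+n i) (∈-suffix⁻ x∈)))
        λ { refl → 1+n≰n (subst (suc i ≤_) position-vertex (∈-suffix⁻ x∈)) }

    -- More common neighbours would give the bad pair {vertex, w} in suffix i.
    few-common-neighbours : ∀ {w} → w ∈ suffix i - vertex → ¬ Adj G vertex w →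
      ∣ (suffix i ∩ Γ vertex) ∩ Γ w ∣ ≤ c ∸ 1
    few-common-neighbours {w} w∈ ¬Adj-vw with ∣ (suffix i ∩ Γ vertex) ∩ Γ w ∣ ≤? c ∸ 1
    ... | yes few = few
    ... | no many with c≤∣p∣⇒injection ((suffix i ∩ Γ vertex) ∩ Γ w) c≤
      where
      c≤ : c ≤ ∣ (suffix i ∩ Γ vertex) ∩ Γ w ∣
      c≤ = subst (_≤ ∣ (suffix i ∩ Γ vertex) ∩ Γ w ∣) (m+[n∸m]≡n 1≤c) (≰⇒> many)
    ... | f , f-inj , f∈ = ⊥-elim (no-bad-pair (fromℕ< i<n) w
      ( suffix⇒Suffix vertex∈suffix , suffix⇒Suffix (p─q⊆p _ ⁅ vertex ⁆ w∈)
      , x∈p-y⇒x≢y w∈ ∘ sym , ¬Adj-vw , f , f-inj , common ))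
      where
      common : ∀ k → Suffix σ (fromℕ< i<n) (f k) × Adj G vertex (f k) × Adj G w (f k)
      common k with x∈p∩q⁻ _ _ (f∈ k)
      ... | f∈S∩Γv , f∈Γw with x∈p∩q⁻ _ _ f∈S∩Γv
      ... | f∈S , f∈Γv = suffix⇒Suffix f∈S , ∈-subsetOf⁻ (Adj? vertex) f∈Γv , ∈-subsetOf⁻ (Adj? w) f∈Γw

  suffix-peelable : ∀ k i → k + i ≡ n → Peelable (c ∸ 1) (suffix i)
  suffix-peelable zero i refl = empty λ (x , x∈) → <⇒≱ (toℕ<n (σ ⟨$⟩ˡ x)) (∈-suffix⁻ x∈)
  suffix-peelable (suc k) i k+i≡n = peel (vertex∈suffix i<n) (few-common-neighbours i<n)
    (subst (Peelable (c ∸ 1)) (sym (suffix-vertex≡suffix-suc i<n))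
           (suffix-peelable k (suc i) (trans (+-suc k i) k+i≡n)))
    where
    i<n : i < n
    i<n = subst (i <_) k+i≡n (s≤s (m≤n+m i k))

  peelable : Peelable (c ∸ 1) ⊤
  peelable = subst (Peelable (c ∸ 1)) (⊆-antisym ⊆⊤ (λ _ → ∈-suffix⁺ z≤n)) (suffix-peelable n 0 (+-identityʳ n))

¬¬-∀-Fin : ∀ {m} {P : Fin m → Set} → (∀ i → ¬ ¬ P i) → ¬ ¬ (∀ i → P i)
¬¬-∀-Fin {zero} _ ¬∀ = ¬∀ λ ()
¬¬-∀-Fin {suc m} ¬¬P ¬∀ = ¬¬P zero λ P-zero → ¬¬-∀-Fin (¬¬P ∘ suc) λ P-suc →
  ¬∀ λ { zero → P-zero ; (suc i) → P-suc i }

-- The bound is decidable, so it may be proved assuming adjacency decidable.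
theorem1p2 : (c n : ℕ) → 1 ≤ c → 1 ≤ n → (G : Graph n) → WeaklyClosed c G →
    (L : List (Subset n)) → Unique L → All (IsMaximalClique G) L →
    length L ^ 3 ≤ 3 ^ (c ∸ 1) * n ^ 6
theorem1p2 c n 1≤c 1≤n G (σ , no-bad-pair) L uL maxL =
  decidable-stable (length L ^ 3 ≤? 3 ^ (c ∸ 1) * n ^ 6) λ ¬bound →
    ¬¬-∀-Fin (λ x → ¬¬-∀-Fin λ y → ¬¬-excluded-middle) λ Adj? →
      ¬bound (MaximalCliques.maximalCliques-bound G Adj? 1≤n
                (WeaklyClosedOrdering.peelable G Adj? 1≤c σ no-bad-pair) uL maxL)
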